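{- Let $G$ be a kinky benzenoid system with hexagons $h_1,\dots,h_n$ ordered as described in the context, and let $S$ be a resonant set of $G$. Then $S$ is a maximal resonant set of $G$ if and only if $b(S)$ is a maximal element of the poset $(\mathcal{L}(G),\leq)$.
   Context: A benzenoid system is a 2-connected plane graph in which every interior face is a hexagon. Two hexagons are adjacent if they share an edge; a hexagon is terminal if it is adjacent to exactly one other hexagon. $G$ is catacondensed if every vertex belongs to at most two hexagons; a hexagon adjacent to exactly two others has two vertices of degree two, and is linearly connected if these are non-adjacent. A kinky benzenoid system is a catacondensed benzenoid system with no linearly connected hexagons. The inner dual $T$ of $G$ (vertices = hexagons, edges = adjacent pairs) is a tree. The hexagons are numbered $h_1,\dots,h_n$ by a depth-first or breadth-first search on $T$ starting at a leaf $h_1$ of $T$, so that $h_i$ is a predecessor (ancestor) of $h_j$ in $T$ rooted at $h_1$ only if $i<j$; for $i\ge 2$, the adjacent predecessor of $h_i$ is its parent in $T$. For a perfect matching $M$ of $G$ and adjacent hexagons $h,h'$, the link from $h$ to $h'$ is the pair of edges of $h$ having exactly one end vertex in $h'$; $M$ contains the link if both these edges lie in $M$. The labeling $\ell$ maps each perfect matching $M$ to a binary string in $\{0,1\}^n$: $(\ell(M))_1=1$ iff $e\in M$, where $e$ is the edge of $h_1$ opposite the common edge of $h_1$ and $h_2$; for $i=2,\dots,n$, $(\ell(M))_i=1$ iff $M$ contains the link from $h_i$ to its adjacent predecessor. $\mathcal{L}(G)$ is the set of all labels $\ell(M)$, partially ordered by $u\le v$ iff $u_i\le v_i$ for all $i$.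 For a perfect matching $M$, a hexagon is $M$-alternating if its edges alternate in and out of $M$. A resonant set is a set $S$ of pairwise disjoint hexagons such that some perfect matching $M$ makes every hexagon of $S$ $M$-alternating; it is maximal if not properly contained in another resonant set. The binary representation $b(S)\in\{0,1\}^n$ has $(b(S))_j=1$ iff $h_j\in S$. -}

module Defs where

open import Data.Nat using (ℕ; suc; _<_)
open import Data.Fin using (Fin; zero; suc; toℕ)
open import Data.Bool using (Bool; true; false)
open import Data.Product using (Σ; _×_; _,_)
open import Data.Sum using (_⊎_)
open import Relation.Binary.PropositionalEquality using (_≡_; _≢_)
open import Relation.Nullary using (¬_)
open import Function.Bundles using (_⇔_)

-- Arithmetic on the six positions of a hexagon (cyclic, mod 6).
-- Vertices of a hexagon are numbered 0..5 cyclically; edge k of a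
-- hexagon joins its vertices k and k+1 (mod 6).

rot : Fin 6 → Fin 6
rot zero = suc zero
rot (suc zero) = suc (suc zero)
rot (suc (suc zero)) = suc (suc (suc zero))
rot (suc (suc (suc zero))) = suc (suc (suc (suc zero)))
rot (suc (suc (suc (suc zero)))) = suc (suc (suc (suc (suc zero))))
rot (suc (suc (suc (suc (suc zero))))) = zero

opp : Fin 6 → Fin 6
opp k = rot (rot (rot k))

p0 p1 p2 p3 p4 p5 : Fin 6
p0 = zero
p1 = rot p0
p2 = rot p1
p3 = rot p2
p4 = rot p3
p5 = rot p4

-- Kinky (catacondensed) benzenoid systems with n = k + 2 hexagons,
-- numbered h_1 = zero, h_2 = suc zero, ..., given by how they are glued.
--
-- Hexagon  suc j  (j : Fin (suc k)) is the non-root hexagon h_{j+2}.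
-- Its adjacent predecessor (parent in the inner dual T rooted at h_1)
-- is  par j , and it is glued along ITS OWN edge 0 (vertices 0,1) to
-- edge  pos j  of the parent (vertices pos j, pos j + 1), with
-- orientation reversed: child vertex 0 = parent vertex (pos j + 1),
-- child vertex 1 = parent vertex (pos j).

record Kinky (k : ℕ) : Set where
  field
    par : Fin (suc k) → Fin (suc (suc k))
    pos : Fin (suc k) → Fin 6
    par-lt : ∀ j → toℕ (par j) < toℕ (suc j)
    -- catacondensed: a child of a non-root hexagon is glued along an
    -- edge disjoint from that hexagon's own parent edge (edge 0)
    pos-ok : ∀ j i → par j ≡ suc i → (pos j ≡ p2 ⊎ pos j ≡ p3 ⊎ pos j ≡ p4)
    -- catacondensed: distinct children of one hexagon are glued along
    -- vertex-disjoint edges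
    siblings : ∀ j j' → j ≢ j' → par j ≡ par j' →
               (pos j' ≢ pos j) × (pos j' ≢ rot (pos j)) × (rot (pos j') ≢ pos j)
    root-leaf : ∀ j j' → par j ≡ zero → par j' ≡ zero → j ≡ j'
    -- kinky: a hexagon with exactly two neighbours (a non-root hexagon
    -- with exactly one child) is not linearly connected, i.e. the edge
    -- where its child is glued is not opposite to its parent edge 0
    kinky : ∀ i j → par j ≡ suc i → (∀ j' → par j' ≡ suc i → j' ≡ j) → pos j ≢ p3

module _ {k : ℕ} (G : Kinky k) where
  open Kinky G

  Hex : Set
  Hex = Fin (suc (suc k))

  -- names of vertices / edges: (hexagon, local position)
  Name : Set
  Name = Hex × Fin 6

  -- canonical name of a vertex (identifies the two glued vertices)
  canonV : Name → Name
  canonV (zero , l) = (zero , l)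
  canonV (suc j , zero) = (par j , rot (pos j))
  canonV (suc j , suc zero) = (par j , pos j)
  canonV (suc j , suc (suc l)) = (suc j , suc (suc l))

  canonE : Name → Name
  canonE (zero , l) = (zero , l)
  canonE (suc j , zero) = (par j , pos j)
  canonE (suc j , suc l) = (suc j , suc l)

  Inc : Name → Name → Set
  Inc (i , l) v = (canonV v ≡ canonV (i , l)) ⊎ (canonV v ≡ canonV (i , rot l))

  -- a set of edges, given by its characteristic function on edge names
  -- (only the value on canonical names matters)
  EdgeSet : Set
  EdgeSet = Name → Bool

  _∈M_ : Name → EdgeSet → Set
  e ∈M M = M (canonE e) ≡ true

  PerfectMatching : EdgeSet → Set
  PerfectMatching M =
    ∀ v → Σ Name λ e → (e ∈M M) × Inc e v ×
          (∀ e' → e' ∈M M → Inc e' v → canonE e' ≡ canonE e)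

  Alternating : EdgeSet → Hex → Set
  Alternating M i =
    ((i , p0) ∈M M × ¬ ((i , p1) ∈M M) × (i , p2) ∈M M ×
       ¬ ((i , p3) ∈M M) × (i , p4) ∈M M × ¬ ((i , p5) ∈M M))
    ⊎
    (¬ ((i , p0) ∈M M) × (i , p1) ∈M M × ¬ ((i , p2) ∈M M) ×
       (i , p3) ∈M M × ¬ ((i , p4) ∈M M) × (i , p5) ∈M M)

  -- i-th coordinate of the label ℓ(M) equals 1
  --  * h_1: the edge of h_1 opposite the common edge of h_1 and h_2
  --    (h_2 = suc zero is glued to edge pos zero of h_1) is in M;
  --  * h_{j+2}: M contains the link from h_{j+2} to its parent, i.e. the
  --    edges 1 (vertices 1,2) and 5 (vertices 5,0) of h_{j+2}, the two
  --    edges having exactly one end vertex in the parent.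
  LabelBit : EdgeSet → Hex → Set
  LabelBit M zero = (zero , opp (pos zero)) ∈M M
  LabelBit M (suc j) = ((suc j , p1) ∈M M) × ((suc j , p5) ∈M M)

  BinString : Set
  BinString = Hex → Bool

  IsLabel : EdgeSet → BinString → Set
  IsLabel M u = ∀ i → (u i ≡ true) ⇔ LabelBit M i

  InL : BinString → Set
  InL u = Σ EdgeSet λ M → PerfectMatching M × IsLabel M u

  _≤b_ : BinString → BinString → Set
  u ≤b v = ∀ i → u i ≡ true → v i ≡ true

  MaximalInL : BinString → Set
  MaximalInL u = InL u × (∀ v → InL v → u ≤b v → v ≤b u)

  HexSet : Set
  HexSet = Hex → Bool

  DisjointHex : Hex → Hex → Set
  DisjointHex i j = ∀ l l' → canonV (i , l) ≢ canonV (j , l')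

  Resonant : HexSet → Set
  Resonant S =
    (∀ i j → S i ≡ true → S j ≡ true → i ≢ j → DisjointHex i j) ×
    Σ EdgeSet λ M → PerfectMatching M × (∀ i → S i ≡ true → Alternating M i)

  _⊆h_ : HexSet → HexSet → Set
  S ⊆h S' = ∀ i → S i ≡ true → S' i ≡ true

  MaximalResonant : HexSet → Set
  MaximalResonant S = Resonant S × (∀ S' → Resonant S' → S ⊆h S' → S' ⊆h S)

  b : HexSet → BinString
  b S = S

{-# OPTIONS --safe #-}
module Submission where

-- For a kinky benzenoid system the resonant sets and the labels in 𝓛(G) are
-- both exactly the independent sets of the inner dual tree (no hexagon together
-- with its parent), so the two families have the same maximal elements.
-- A resonant set is independent because a hexagon shares vertices with its
-- parent. A label is independent because the links of a hexagon and of its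
-- parent would cover a common vertex twice (for h₁ and h₂, a vertex of h₁ would
-- stay uncovered). Conversely, for an independent S, the matching in which the
-- hexagons of S take their odd edges and all others their even edges, except
-- those shared with a child in S, is perfect, makes every hexagon of S
-- alternating and has label S. Both directions use that in a kinky system every
-- child is glued at an even edge of its parent.

open import Defs
open import Data.Nat using (ℕ; s≤s)
open import Data.Nat.Properties using (<-irrefl)
open import Data.Fin using (Fin; zero; suc; toℕ; inject₁)
open import Data.Fin.Properties using (_≟_; any?; 0≢1+n)
open import Data.Bool using (Bool; true; false; not; _∨_; _xor_; if_then_else_)
import Data.Bool.Properties as Bool
open import Data.Product using (∃; _×_; _,_; proj₁; proj₂)
open import Data.Sum using (_⊎_; inj₁; inj₂)
open import Data.Empty using (⊥; ⊥-elim)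
open import Function using (_∘_)
open import Function.Bundles using (_⇔_; mk⇔; Equivalence)
open import Relation.Binary.PropositionalEquality
open import Relation.Nullary using (¬_; Dec; does)
open import Relation.Nullary.Decidable using (decidable-stable; _×-dec_; dec-true; dec-false; yes; no)
open import Relation.Unary using (_≐_)
open import Relation.Unary.Properties using (≐-sym; ≐-trans)

open ≡-Reasoning

rot⁻¹ : Fin 6 → Fin 6
rot⁻¹ zero = p5
rot⁻¹ (suc l) = inject₁ l

rot-rot⁻¹ : ∀ l → rot (rot⁻¹ l) ≡ l
rot-rot⁻¹ zero = refl
rot-rot⁻¹ (suc zero) = refl
rot-rot⁻¹ (suc (suc zero)) = refl
rot-rot⁻¹ (suc (suc (suc zero))) = refl
rot-rot⁻¹ (suc (suc (suc (suc zero)))) = refl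
rot-rot⁻¹ (suc (suc (suc (suc (suc zero))))) = refl

rot⁻¹-rot : ∀ l → rot⁻¹ (rot l) ≡ l
rot⁻¹-rot zero = refl
rot⁻¹-rot (suc zero) = refl
rot⁻¹-rot (suc (suc zero)) = refl
rot⁻¹-rot (suc (suc (suc zero))) = refl
rot⁻¹-rot (suc (suc (suc (suc zero)))) = refl
rot⁻¹-rot (suc (suc (suc (suc (suc zero))))) = refl

rot-injective : ∀ {l l′} → rot l ≡ rot l′ → l ≡ l′
rot-injective {l} {l′} eq = begin
  l              ≡⟨ sym (rot⁻¹-rot l) ⟩
  rot⁻¹ (rot l)  ≡⟨ cong rot⁻¹ eq ⟩
  rot⁻¹ (rot l′) ≡⟨ rot⁻¹-rot l′ ⟩
  l′             ∎

rot-≢ : ∀ l → rot l ≢ l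
rot-≢ zero ()
rot-≢ (suc zero) ()
rot-≢ (suc (suc zero)) ()
rot-≢ (suc (suc (suc zero))) ()
rot-≢ (suc (suc (suc (suc zero)))) ()
rot-≢ (suc (suc (suc (suc (suc zero))))) ()

rot²-≢ : ∀ l → rot (rot l) ≢ l
rot²-≢ zero ()
rot²-≢ (suc zero) ()
rot²-≢ (suc (suc zero)) ()
rot²-≢ (suc (suc (suc zero))) ()
rot²-≢ (suc (suc (suc (suc zero)))) ()
rot²-≢ (suc (suc (suc (suc (suc zero))))) ()

parity : Fin 6 → Bool
parity zero = false
parity (suc zero) = true
parity (suc (suc zero)) = false
parity (suc (suc (suc zero))) = true
parity (suc (suc (suc (suc zero)))) = false
parity (suc (suc (suc (suc (suc zero))))) = true

parity-rot : ∀ l → parity (rot l) ≡ not (parity l)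
parity-rot zero = refl
parity-rot (suc zero) = refl
parity-rot (suc (suc zero)) = refl
parity-rot (suc (suc (suc zero))) = refl
parity-rot (suc (suc (suc (suc zero)))) = refl
parity-rot (suc (suc (suc (suc (suc zero))))) = refl

Maximal : {A : Set} → (A → Set) → (A → A → Set) → A → Set
Maximal P _≤_ x = P x × (∀ y → P y → x ≤ y → y ≤ x)

maximal-resp-≐ : {A : Set} {P Q : A → Set} (_≤_ : A → A → Set) →
                 P ≐ Q → ∀ x → Maximal P _≤_ x ⇔ Maximal Q _≤_ x
maximal-resp-≐ _ (P⊆Q , Q⊆P) x =
  mk⇔ (λ (px , max) → P⊆Q px , λ y qy → max y (Q⊆P qy))
      (λ (qx , max) → Q⊆P qx , λ y py → max y (P⊆Q py))

module _ {k : ℕ} (G : Kinky k) where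
  open Kinky G

  par-zero : par zero ≡ zero
  par-zero with par zero | par-lt zero
  ... | zero  | _      = refl
  ... | suc _ | s≤s ()

  par≢suc : ∀ c → par c ≢ suc c
  par≢suc c eq = <-irrefl (cong toℕ eq) (par-lt c)

  child-of-root : ∀ {c} → par c ≡ zero → c ≡ zero
  child-of-root pc = root-leaf _ zero pc par-zero

  ChildOf : Hex G → Hex G → Set
  ChildOf i j = ∃ λ c → i ≡ suc c × par c ≡ j

  Touches : Fin (ℕ.suc k) → Fin 6 → Set
  Touches c l = l ≡ pos c ⊎ l ≡ rot (pos c)

  siblings-touching : ∀ {a c l} → par a ≡ par c → Touches a l → Touches c l → a ≡ c
  siblings-touching {a} {c} pa≡pc ta tc =
    decidable-stable (a ≟ c) λ a≢c → apart (siblings a c a≢c pa≡pc) ta tc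
    where
    apart : ∀ {l} → (pos c ≢ pos a) × (pos c ≢ rot (pos a)) × (rot (pos c) ≢ pos a) →
            Touches a l → Touches c l → ⊥
    apart (≢pos , _ , _) (inj₁ refl) (inj₁ tc) = ≢pos (sym tc)
    apart (_ , _ , rot≢) (inj₁ refl) (inj₂ tc) = rot≢ (sym tc)
    apart (_ , ≢rot , _) (inj₂ refl) (inj₁ tc) = ≢rot (sym tc)
    apart (≢pos , _ , _) (inj₂ refl) (inj₂ tc) = ≢pos (rot-injective (sym tc))

  -- A child glued at edge 3 would be an only child, since siblings at 2, 3 or 4
  -- would share a vertex with it; kinkiness forbids this.
  child-pos : ∀ {c i} → par c ≡ suc i → pos c ≡ p2 ⊎ pos c ≡ p4
  child-pos {c} {i} pc with pos-ok c i pc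
  ... | inj₁ p≡2 = inj₁ p≡2
  ... | inj₂ (inj₂ p≡4) = inj₂ p≡4
  ... | inj₂ (inj₁ p≡3) = ⊥-elim (kinky i c pc only-child p≡3)
    where
    only-child : ∀ c′ → par c′ ≡ suc i → c′ ≡ c
    only-child c′ pc′ = decidable-stable (c′ ≟ c) λ c′≢c →
      apart (siblings c c′ (c′≢c ∘ sym) (trans pc (sym pc′))) (pos-ok c′ i pc′)
      where
      apart : (pos c′ ≢ pos c) × (pos c′ ≢ rot (pos c)) × (rot (pos c′) ≢ pos c) →
              pos c′ ≡ p2 ⊎ pos c′ ≡ p3 ⊎ pos c′ ≡ p4 → ⊥
      apart (_ , _ , rot≢) (inj₁ q) = rot≢ (trans (cong rot q) (sym p≡3))
      apart (≢pos , _ , _) (inj₂ (inj₁ q)) = ≢pos (trans q (sym p≡3))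
      apart (_ , ≢rot , _) (inj₂ (inj₂ q)) = ≢rot (trans q (sym (cong rot p≡3)))

  -- Edge parity is measured from the edge joining a hexagon to its parent
  -- (for h₁: to h₂), which is thus even.
  base : Hex G → Fin 6
  base zero = pos zero
  base (suc _) = p0

  odd : Hex G → Fin 6 → Bool
  odd i l = parity l xor parity (base i)

  odd-base : ∀ i → odd i (base i) ≡ false
  odd-base i = Bool.xor-same (parity (base i))

  odd-rot : ∀ i l → odd i (rot l) ≡ not (odd i l)
  odd-rot i l = begin
    parity (rot l) xor parity (base i)   ≡⟨ cong (_xor parity (base i)) (parity-rot l) ⟩
    not (parity l) xor parity (base i)   ≡⟨ sym (Bool.not-distribˡ-xor (parity l) _) ⟩
    not (odd i l)                        ∎

  odd-rot⁻¹ : ∀ i l → odd i (rot⁻¹ l) ≡ not (odd i l)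
  odd-rot⁻¹ i l = begin
    odd i (rot⁻¹ l)                ≡⟨ sym (Bool.not-involutive _) ⟩
    not (not (odd i (rot⁻¹ l)))    ≡⟨ cong not (sym (odd-rot i (rot⁻¹ l))) ⟩
    not (odd i (rot (rot⁻¹ l)))    ≡⟨ cong (not ∘ odd i) (rot-rot⁻¹ l) ⟩
    not (odd i l)                  ∎

  odd-opp : ∀ i l → odd i (opp l) ≡ not (odd i l)
  odd-opp i l = begin
    odd i (rot (rot (rot l)))    ≡⟨ odd-rot i (rot (rot l)) ⟩
    not (odd i (rot (rot l)))    ≡⟨ cong not (odd-rot i (rot l)) ⟩
    not (not (odd i (rot l)))    ≡⟨ Bool.not-involutive _ ⟩
    odd i (rot l)                ≡⟨ odd-rot i l ⟩
    not (odd i l)                ∎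

  child-even : ∀ c → odd (par c) (pos c) ≡ false
  child-even c with par c in pc
  ... | zero rewrite child-of-root pc = odd-base zero
  ... | suc i with child-pos pc
  ...   | inj₁ p≡2 rewrite p≡2 = refl
  ...   | inj₂ p≡4 rewrite p≡4 = refl

  odd-after-child : ∀ c → odd (par c) (rot (pos c)) ≡ true
  odd-after-child c = trans (odd-rot (par c) (pos c)) (cong not (child-even c))

  odd-before-child : ∀ {c l} → rot l ≡ pos c → odd (par c) l ≡ true
  odd-before-child {c} {l} r = Bool.not-injective (begin
    not (odd (par c) l)        ≡⟨ sym (odd-rot (par c) l) ⟩
    odd (par c) (rot l)        ≡⟨ cong (odd (par c)) r ⟩
    odd (par c) (pos c)        ≡⟨ child-even c ⟩
    false                      ∎)

  touched-canonical : ∀ {c l} → Touches c l → canonV G (par c , l) ≡ (par c , l)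
  touched-canonical {c} t with par c in pc
  ... | zero = refl
  ... | suc i with child-pos pc | t
  ...   | inj₁ p≡2 | inj₁ refl rewrite p≡2 = refl
  ...   | inj₁ p≡2 | inj₂ refl rewrite p≡2 = refl
  ...   | inj₂ p≡4 | inj₁ refl rewrite p≡4 = refl
  ...   | inj₂ p≡4 | inj₂ refl rewrite p≡4 = refl

  canonV-idem : ∀ v → canonV G (canonV G v) ≡ canonV G v
  canonV-idem (zero , l) = refl
  canonV-idem (suc j , zero) = touched-canonical (inj₂ refl)
  canonV-idem (suc j , suc zero) = touched-canonical (inj₁ refl)
  canonV-idem (suc j , suc (suc l)) = refl

  canonV-fixed : ∀ {v i l} → canonV G v ≡ (i , l) → canonV G (i , l) ≡ (i , l)
  canonV-fixed {v} v≡ = trans (cong (canonV G) (sym v≡)) (trans (canonV-idem v) v≡)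

  canonE-own-edges : ∀ {i l} → canonV G (i , l) ≡ (i , l) →
                     canonE G (i , l) ≡ (i , l) × canonE G (i , rot⁻¹ l) ≡ (i , rot⁻¹ l)
  canonE-own-edges {zero} _ = refl , refl
  canonE-own-edges {suc j} {zero} fixed = ⊥-elim (par≢suc j (cong proj₁ fixed))
  canonE-own-edges {suc j} {suc zero} fixed = ⊥-elim (par≢suc j (cong proj₁ fixed))
  canonE-own-edges {suc j} {suc (suc l)} _ = refl , refl

  data VertexView : Hex G → Fin 6 → Set where
    own    : ∀ {i l} → canonV G (i , l) ≡ (i , l) → VertexView i l
    shared : ∀ {c l} m → Touches c m → canonV G (suc c , l) ≡ (par c , m) → VertexView (suc c) l

  vertexView : ∀ i l → VertexView i l
  vertexView zero l = own refl
  vertexView (suc c) zero = shared (rot (pos c)) (inj₂ refl) refl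
  vertexView (suc c) (suc zero) = shared (pos c) (inj₁ refl) refl
  vertexView (suc c) (suc (suc l)) = own refl

  shared-vertex⇒adjacent : ∀ {i l j l′} → canonV G (i , l) ≡ canonV G (j , l′) → i ≢ j →
                           ChildOf i j ⊎ ChildOf j i
  shared-vertex⇒adjacent {i} {l} {j} {l′} eq i≢j with vertexView i l | vertexView j l′
  ... | own e | own e′ = ⊥-elim (i≢j (cong proj₁ (trans (sym e) (trans eq e′))))
  ... | own e | shared {c} _ _ e′ = inj₂ (c , refl , cong proj₁ (trans (sym e′) (trans (sym eq) e)))
  ... | shared {c} _ _ e | own e′ = inj₁ (c , refl , cong proj₁ (trans (sym e) (trans eq e′)))
  ... | shared {a} m ta e | shared {c} m′ tc e′ =
    ⊥-elim (i≢j (cong suc (siblings-touching (cong proj₁ same) ta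
                                               (subst (Touches c) (sym (cong proj₂ same)) tc))))
    where
    same : (par a , m) ≡ (par c , m′)
    same = trans (sym e) (trans eq e′)

  -- The canonical edges at the vertex (i , l): edge 0 of a child is edge `pos c`
  -- of its parent, so only its links 1 and 5 reach the parent's vertices
  -- `pos c` and `pos c + 1`.
  data EdgeAt (i : Hex G) (l : Fin 6) : Name G → Set where
    next     : EdgeAt i l (i , l)
    previous : ∀ {l′} → rot l′ ≡ l → EdgeAt i l (i , l′)
    link₁    : ∀ {c} → par c ≡ i → pos c ≡ l → EdgeAt i l (suc c , p1)
    link₅    : ∀ {c} → par c ≡ i → rot (pos c) ≡ l → EdgeAt i l (suc c , p5)

  edgeAt′ : ∀ w e → w ≡ canonV G e ⊎ w ≡ canonV G (proj₁ e , rot (proj₂ e)) →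
            EdgeAt (proj₁ w) (proj₂ w) (canonE G e)
  edgeAt′ _ (zero , l) (inj₁ refl) = next
  edgeAt′ _ (zero , l) (inj₂ refl) = previous refl
  edgeAt′ _ (suc j , zero) (inj₁ refl) = previous refl
  edgeAt′ _ (suc j , zero) (inj₂ refl) = next
  edgeAt′ _ (suc j , suc zero) (inj₁ refl) = link₁ refl refl
  edgeAt′ _ (suc j , suc zero) (inj₂ refl) = previous refl
  edgeAt′ _ (suc j , suc (suc l)) (inj₁ refl) = next
  edgeAt′ _ (suc j , suc (suc zero)) (inj₂ refl) = previous refl
  edgeAt′ _ (suc j , suc (suc (suc zero))) (inj₂ refl) = previous refl
  edgeAt′ _ (suc j , suc (suc (suc (suc zero)))) (inj₂ refl) = previous refl
  edgeAt′ _ (suc j , suc (suc (suc (suc (suc zero))))) (inj₂ refl) = link₅ refl refl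

  edgeAt : ∀ {v e} → Inc G e v → EdgeAt (proj₁ (canonV G v)) (proj₂ (canonV G v)) (canonE G e)
  edgeAt {v} {e} = edgeAt′ (canonV G v) e

  perfect-unique : ∀ {M} → PerfectMatching G M → ∀ v {e e′} →
                   M (canonE G e) ≡ true → M (canonE G e′) ≡ true → Inc G e v → Inc G e′ v →
                   canonE G e ≡ canonE G e′
  perfect-unique pm v me me′ ie ie′ with pm v
  ... | _ , _ , _ , unique = trans (unique _ me ie) (sym (unique _ me′ ie′))

  -- Vertex r + 2 of h₁ (r = pos zero) can only be covered by its edges r + 1 and
  -- r + 2, which meet the link 5 of h₂ and the labelled edge r + 3 respectively.
  root-child-labels : ∀ {M} → PerfectMatching G M →
                      LabelBit G M (suc zero) → LabelBit G M zero → ⊥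
  root-child-labels {M} pm (_ , m₅) m-opp with pm (zero , rot (rot (pos zero)))
  ... | e , me , ie , _ = unmatched (edgeAt {zero , rot (rot r)} ie) me
    where
    r : Fin 6
    r = pos zero
    unmatched : ∀ {x} → EdgeAt zero (rot (rot r)) x → M x ≡ true → ⊥
    unmatched next mx = rot-≢ (rot (rot r)) (sym (cong proj₂
      (perfect-unique {M} pm (zero , opp r) {zero , rot (rot r)} {zero , opp r} mx m-opp
        (inj₂ refl) (inj₁ refl))))
    unmatched (previous rl) mx with rot-injective rl
    ... | refl = 0≢1+n (cong proj₁
      (perfect-unique {M} pm (zero , rot r) {zero , rot r} {suc zero , p5} mx m₅ (inj₁ refl)
        (inj₂ (cong (_, rot r) (sym par-zero)))))
    unmatched (link₁ pc pl) _ with child-of-root pc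
    ... | refl = rot²-≢ r (sym pl)
    unmatched (link₅ pc pl) _ with child-of-root pc
    ... | refl = rot-≢ r (sym (rot-injective pl))

  -- Kinkiness enters here: a child glued at edge 3 would meet neither link of its parent.
  inner-child-labels : ∀ {M c i} → PerfectMatching G M → par c ≡ suc i →
                       LabelBit G M (suc c) → LabelBit G M (suc i) → ⊥
  inner-child-labels {M} {c} {i} pm pc (m₁ , m₅) (n₁ , n₅) with child-pos pc
  ... | inj₁ p≡2 = par≢suc c (trans pc (cong proj₁
        (perfect-unique {M} pm (suc i , p2) {suc i , p1} {suc c , p1} n₁ m₁ (inj₂ refl)
          (inj₁ (sym (cong₂ _,_ pc p≡2))))))
  ... | inj₂ p≡4 = par≢suc c (trans pc (cong proj₁
        (perfect-unique {M} pm (suc i , p5) {suc i , p5} {suc c , p5} n₅ m₅ (inj₁ refl)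
          (inj₂ (sym (cong₂ _,_ pc (cong rot p≡4)))))))

  parent-child-labels : ∀ {M c} p → par c ≡ p → PerfectMatching G M →
                        LabelBit G M (suc c) → LabelBit G M p → ⊥
  parent-child-labels {M} zero pc pm with child-of-root pc
  ... | refl = root-child-labels {M} pm
  parent-child-labels {M} (suc i) pc pm = inner-child-labels {M} pm pc

  Independent : HexSet G → Set
  Independent S = ∀ c → S (suc c) ≡ true → S (par c) ≡ false

  resonant⇒independent : ∀ {S} → Resonant G S → Independent S
  resonant⇒independent (disjoint , _) c s = Bool.¬-not λ s-par →
    disjoint (par c) (suc c) s-par s (par≢suc c) (pos c) p1 (touched-canonical (inj₁ refl))

  inL⇒independent : ∀ {u} → InL G u → Independent u
  inL⇒independent (M , pm , label) c s = Bool.¬-not λ s-par →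
    parent-child-labels {M} (par c) refl pm (Equivalence.to (label (suc c)) s)
                                            (Equivalence.to (label (par c)) s-par)

  module FromIndependent (S : HexSet G) (independent : Independent S) where

    ChildAt : Hex G → Fin 6 → Set
    ChildAt i l = ∃ λ c → par c ≡ i × pos c ≡ l × S (suc c) ≡ true

    childAt? : ∀ i l → Dec (ChildAt i l)
    childAt? i l = any? λ c → par c ≟ i ×-dec pos c ≟ l ×-dec S (suc c) Bool.≟ true

    matching : EdgeSet G
    matching (i , l) = if odd i l then S i else not (S i ∨ does (childAt? i l))

    matching-odd : ∀ {i l} → odd i l ≡ true → matching (i , l) ≡ S i
    matching-odd o rewrite o = refl

    matching-even : ∀ {i l} → odd i l ≡ false → matching (i , l) ≡ not (S i ∨ does (childAt? i l))
    matching-even o rewrite o = refl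

    matched-even : ∀ {i l} → odd i l ≡ false → matching (i , l) ≡ true →
                   S i ≡ false × ¬ ChildAt i l
    matched-even {i} {l} o m =
      Bool.∨-conicalˡ (S i) _ neither ,
      λ child → Bool.not-¬ (dec-true (childAt? i l) child) (Bool.∨-conicalʳ (S i) _ neither)
      where
      neither : S i ∨ does (childAt? i l) ≡ false
      neither = Bool.not-injective (trans (sym (matching-even {i} {l} o)) m)

    even-matched : ∀ {i l} → odd i l ≡ false → S i ≡ false → ¬ ChildAt i l →
                   matching (i , l) ≡ true
    even-matched {i} {l} o s none rewrite o | s | dec-false (childAt? i l) none = refl

    matched-parity : ∀ {i l} → matching (i , l) ≡ true → odd i l ≡ S i
    matched-parity {i} {l} m with odd i l in o
    ... | true = sym m
    ... | false = sym (proj₁ (matched-even {i} {l} o (trans (matching-even {i} {l} o) m)))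

    odd-matched : ∀ {i l} → odd i l ≡ true → S i ≡ true → matching (i , l) ≡ true
    odd-matched {i} {l} o s = trans (matching-odd {i} {l} o) s

    even-unmatched : ∀ {i l} → odd i l ≡ false → S i ≡ true → ¬ matching (i , l) ≡ true
    even-unmatched {i} {l} o s m =
      Bool.not-¬ refl (trans (sym o) (trans (matched-parity {i} {l} m) s))

    next-previous : ∀ {i l l′} → rot l′ ≡ l →
                    matching (i , l) ≡ true → matching (i , l′) ≡ true → ⊥
    next-previous {i} {l} {l′} r m m′ = Bool.not-¬ refl (begin
      odd i l′         ≡⟨ matched-parity {i} {l′} m′ ⟩
      S i              ≡⟨ sym (matched-parity {i} {l} m) ⟩
      odd i l          ≡⟨ cong (odd i) (sym r) ⟩
      odd i (rot l′)   ≡⟨ odd-rot i l′ ⟩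
      not (odd i l′)   ∎)

    next-link₁ : ∀ {i l c} → par c ≡ i → pos c ≡ l →
                 matching (i , l) ≡ true → S (suc c) ≡ true → ⊥
    next-link₁ {c = c} refl refl m s =
      proj₂ (matched-even {par c} even m) (c , refl , refl , s)
      where
      even : odd (par c) (pos c) ≡ false
      even = trans (matched-parity {par c} m) (independent c s)

    next-link₅ : ∀ {i l c} → par c ≡ i → rot (pos c) ≡ l →
                 matching (i , l) ≡ true → S (suc c) ≡ true → ⊥
    next-link₅ {c = c} refl refl m s =
      Bool.not-¬ (odd-after-child c) (trans (matched-parity {par c} m) (independent c s))

    previous-link₁ : ∀ {i l′ c} → par c ≡ i → rot l′ ≡ pos c →
                     matching (i , l′) ≡ true → S (suc c) ≡ true → ⊥
    previous-link₁ {c = c} refl r m s =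
      Bool.not-¬ (odd-before-child r) (trans (matched-parity {par c} m) (independent c s))

    previous-link₅ : ∀ {i l′ c} → par c ≡ i → l′ ≡ pos c →
                     matching (i , l′) ≡ true → S (suc c) ≡ true → ⊥
    previous-link₅ {c = c} refl refl m s =
      proj₂ (matched-even {par c} (child-even c) m) (c , refl , refl , s)

    link₁-link₅ : ∀ {i l c c′} → par c ≡ i → pos c ≡ l → par c′ ≡ i → rot (pos c′) ≡ l → ⊥
    link₁-link₅ {c = c} {c′} pc pl pc′ pl′
      with siblings-touching (trans pc (sym pc′)) (inj₁ (sym pl)) (inj₂ (sym pl′))
    ... | refl = rot-≢ (pos c) (trans pl′ (sym pl))

    matched-edge-unique : ∀ {i l x y} → EdgeAt i l x → EdgeAt i l y →
                          matching x ≡ true → matching y ≡ true → x ≡ y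
    matched-edge-unique next next _ _ = refl
    matched-edge-unique next (previous r) m m′ = ⊥-elim (next-previous r m m′)
    matched-edge-unique next (link₁ pc pl) m m′ = ⊥-elim (next-link₁ pc pl m m′)
    matched-edge-unique next (link₅ pc pl) m m′ = ⊥-elim (next-link₅ pc pl m m′)
    matched-edge-unique (previous r) next m m′ = ⊥-elim (next-previous r m′ m)
    matched-edge-unique (previous r) (previous r′) _ _ = cong (_ ,_) (rot-injective (trans r (sym r′)))
    matched-edge-unique (previous r) (link₁ pc pl) m m′ =
      ⊥-elim (previous-link₁ pc (trans r (sym pl)) m m′)
    matched-edge-unique (previous r) (link₅ pc pl) m m′ =
      ⊥-elim (previous-link₅ pc (rot-injective (trans r (sym pl))) m m′)
    matched-edge-unique (link₁ pc pl) next m m′ = ⊥-elim (next-link₁ pc pl m′ m)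
    matched-edge-unique (link₁ pc pl) (previous r) m m′ =
      ⊥-elim (previous-link₁ pc (trans r (sym pl)) m′ m)
    matched-edge-unique (link₁ pc pl) (link₁ pc′ pl′) _ _ =
      cong (λ c → suc c , p1) (siblings-touching (trans pc (sym pc′)) (inj₁ (sym pl)) (inj₁ (sym pl′)))
    matched-edge-unique (link₁ pc pl) (link₅ pc′ pl′) _ _ = ⊥-elim (link₁-link₅ pc pl pc′ pl′)
    matched-edge-unique (link₅ pc pl) next m m′ = ⊥-elim (next-link₅ pc pl m′ m)
    matched-edge-unique (link₅ pc pl) (previous r) m m′ =
      ⊥-elim (previous-link₅ pc (rot-injective (trans r (sym pl))) m′ m)
    matched-edge-unique (link₅ pc pl) (link₁ pc′ pl′) _ _ = ⊥-elim (link₁-link₅ pc′ pl′ pc pl)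
    matched-edge-unique (link₅ pc pl) (link₅ pc′ pl′) _ _ =
      cong (λ c → suc c , p5) (siblings-touching (trans pc (sym pc′)) (inj₂ (sym pl)) (inj₂ (sym pl′)))

    own-edge-of-parity : ∀ i l b → ∃ λ l′ → (l′ ≡ l ⊎ l′ ≡ rot⁻¹ l) × odd i l′ ≡ b
    own-edge-of-parity i l b with odd i l Bool.≟ b
    ... | yes o = l , inj₁ refl , o
    ... | no o = rot⁻¹ l , inj₂ refl , trans (odd-rot⁻¹ i l) (sym (Bool.¬-not (o ∘ sym)))

    own-edge-matched : ∀ v {i l l′} → canonV G v ≡ (i , l) → l′ ≡ l ⊎ l′ ≡ rot⁻¹ l →
                       matching (i , l′) ≡ true → ∃ λ e → matching (canonE G e) ≡ true × Inc G e v
    own-edge-matched v {i} {l} v≡ which m with canonE-own-edges (canonV-fixed v≡) | which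
    ... | canon , _ | inj₁ refl =
      (i , l) , trans (cong matching canon) m , inj₁ (trans v≡ (sym (canonV-fixed v≡)))
    ... | _ , canon | inj₂ refl =
      (i , rot⁻¹ l) , trans (cong matching canon) m ,
      inj₂ (trans v≡ (sym (trans (cong (λ l′ → canonV G (i , l′)) (rot-rot⁻¹ l)) (canonV-fixed v≡))))

    matched-edge-at : ∀ v {i l} → canonV G v ≡ (i , l) →
                      ∃ λ e → matching (canonE G e) ≡ true × Inc G e v
    matched-edge-at v {i} {l} v≡ with S i in s | childAt? i l | childAt? i (rot⁻¹ l)
    ... | true | _ | _ with own-edge-of-parity i l true
    ...   | l′ , which , o = own-edge-matched v v≡ which (odd-matched {i} {l′} o s)
    matched-edge-at v {i} {l} v≡ | false | yes (c , pc , pl , sc) | _ =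
      (suc c , p1) , sc , inj₁ (trans v≡ (sym (cong₂ _,_ pc pl)))
    matched-edge-at v {i} {l} v≡ | false | no _ | yes (c , pc , pl , sc) =
      (suc c , p5) , sc , inj₂ (trans v≡ (sym (cong₂ _,_ pc (trans (cong rot pl) (rot-rot⁻¹ l)))))
    matched-edge-at v {i} {l} v≡ | false | no none | no none⁻ with own-edge-of-parity i l false
    ...   | l′ , which , o =
      own-edge-matched v v≡ which (even-matched {i} {l′} o s (childless which))
      where
      childless : ∀ {l′} → l′ ≡ l ⊎ l′ ≡ rot⁻¹ l → ¬ ChildAt i l′
      childless (inj₁ refl) = none
      childless (inj₂ refl) = none⁻

    perfect : PerfectMatching G matching
    perfect v with matched-edge-at v refl
    ... | e , me , ie =
      e , me , ie , λ e′ me′ ie′ → matched-edge-unique (edgeAt ie′) (edgeAt ie) me′ me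

    labelled : IsLabel G matching S
    labelled zero = mk⇔ (trans opp-matching) (trans (sym opp-matching))
      where
      opp-matching : matching (zero , opp (pos zero)) ≡ S zero
      opp-matching = matching-odd {zero} (trans (odd-opp zero (pos zero)) (cong not (odd-base zero)))
    labelled (suc j) = mk⇔ (λ s → s , s) proj₁

    alternating : ∀ i → S i ≡ true → Alternating G matching i
    alternating zero s = by-parity (parity (pos zero)) refl
      where
      by-parity : ∀ b → parity (pos zero) ≡ b → Alternating G matching zero
      by-parity true e = inj₁ (odd-matched {zero} {p0} e s , even-unmatched {zero} {p1} (cong not e) s ,
                               odd-matched {zero} {p2} e s , even-unmatched {zero} {p3} (cong not e) s ,
                               odd-matched {zero} {p4} e s , even-unmatched {zero} {p5} (cong not e) s)
      by-parity false e = inj₂ (even-unmatched {zero} {p0} e s , odd-matched {zero} {p1} (cong not e) s ,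
                                even-unmatched {zero} {p2} e s , odd-matched {zero} {p3} (cong not e) s ,
                                even-unmatched {zero} {p4} e s , odd-matched {zero} {p5} (cong not e) s)
    alternating (suc j) s =
      inj₂ (parent-edge , s , even-unmatched {suc j} {p2} refl s , s , even-unmatched {suc j} {p4} refl s , s)
      where
      parent-edge : ¬ matching (par j , pos j) ≡ true
      parent-edge m = proj₂ (matched-even {par j} (child-even j) m) (j , refl , refl , s)

    disjoint : ∀ i j → S i ≡ true → S j ≡ true → i ≢ j → DisjointHex G i j
    disjoint i j si sj i≢j l l′ eq with shared-vertex⇒adjacent eq i≢j
    ... | inj₁ (c , refl , refl) = Bool.not-¬ (independent c si) sj
    ... | inj₂ (c , refl , refl) = Bool.not-¬ (independent c sj) si

    resonant : Resonant G S
    resonant = disjoint , matching , perfect , alternating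

    inL : InL G S
    inL = matching , perfect , labelled

  resonant≐independent : Resonant G ≐ Independent
  resonant≐independent = resonant⇒independent , λ {S} → FromIndependent.resonant S

  inL≐independent : InL G ≐ Independent
  inL≐independent = inL⇒independent , λ {S} → FromIndependent.inL S

-- The resonance hypothesis is redundant: each side asserts membership in its family.
lemma2 : (k : ℕ) (G : Kinky k) (S : HexSet G) → Resonant G S →
    MaximalResonant G S ⇔ MaximalInL G (b G S)
lemma2 k G S _ =
  maximal-resp-≐ {P = Resonant G} {Q = InL G} (_⊆h_ G)
    (≐-trans (resonant≐independent G) (≐-sym (inL≐independent G))) S
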